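{- Let $\mathcal{C}$ be a restriction category and $T$ an affine symmetric monoidal monad on $\mathcal{C}$. Then the Kleisli category $\mathcal{C}_T$ is a domain category.
   Context: Composition is diagrammatic ($f;g$ means first $f$, then $g$); the right unitor is $\rho_X:X\to X\otimes I$. A gs-monoidal category is a symmetric monoidal category with, for each object $X$, a discharger $!_X:X\to I$ and duplicator $\nabla_X:X\to X\otimes X$, compatible with the monoidal structure, with $\nabla_X$ coassociative, cocommutative, and $(X,\nabla_X,!_X)$ a comonoid. A restriction category is a gs-monoidal category in which every arrow $f:X\to Y$ satisfies $f;\nabla_Y=\nabla_X;(f\otimes f)$. A symmetric monoidal monad $(T,\eta,\mu)$ is a monad whose functor is lax symmetric monoidal with structure $c_{X,Y}:TX\otimes TY\to T(X\otimes Y)$ and $\eta_I:I\to TI$, such that $\eta,\mu$ are monoidal natural transformations; it is affine if $T(!_X)=!_{TX};\eta_I$ for all $X$. The Kleisli category $\mathcal{C}_T$ has arrows $X\to Y$ the arrows $X\to TY$, composition $f;^\sharp g=f;T(g);\mu$, tensor $f\otimes^\sharp g=(f\otimes g);c$, and structural arrows $\nabla_X;\eta_{X\otimes X}$, $!_X;\eta_I$. For $f:X\to Y$ in a gs-monoidal category, $\mathrm{dom}(f):=\nabla_X;(\mathrm{id}_X\otimes(f;!_Y));\rho^{ -1}_X$; a domain category is one with $\mathrm{dom}(f);f=f$ for all $f$. -}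

module Defs where

open import Level using (Level; _⊔_; suc)
open import Relation.Binary using (Rel; IsEquivalence)

-- Categories with hom-setoids; composition is written diagrammatically:
-- f ⨾ g  means first f, then g.
record Category (o ℓ e : Level) : Set (suc (o ⊔ ℓ ⊔ e)) where
  infixr 9 _⨾_
  infix  4 _≈_
  field
    Obj   : Set o
    _⇒_   : Obj → Obj → Set ℓ
    _≈_   : ∀ {A B} → Rel (A ⇒ B) e
    id    : ∀ {A} → A ⇒ A
    _⨾_   : ∀ {A B C} → A ⇒ B → B ⇒ C → A ⇒ C
    equiv : ∀ {A B} → IsEquivalence (_≈_ {A} {B})
    ⨾-resp-≈ : ∀ {A B C} {f f' : A ⇒ B} {g g' : B ⇒ C} →
               f ≈ f' → g ≈ g' → f ⨾ g ≈ f' ⨾ g'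
    assoc : ∀ {A B C D} {f : A ⇒ B} {g : B ⇒ C} {h : C ⇒ D} →
            (f ⨾ g) ⨾ h ≈ f ⨾ (g ⨾ h)
    idˡ   : ∀ {A B} {f : A ⇒ B} → id ⨾ f ≈ f
    idʳ   : ∀ {A B} {f : A ⇒ B} → f ⨾ id ≈ f

record SymmetricMonoidal {o ℓ e} (C : Category o ℓ e) : Set (o ⊔ ℓ ⊔ e) where
  open Category C
  infixr 10 _⊗₀_ _⊗₁_
  field
    _⊗₀_ : Obj → Obj → Obj
    _⊗₁_ : ∀ {A B C D} → A ⇒ B → C ⇒ D → (A ⊗₀ C) ⇒ (B ⊗₀ D)
    I    : Obj
    ⊗-id   : ∀ {A B} → id {A} ⊗₁ id {B} ≈ id
    ⊗-comp : ∀ {A B C D E F} {f : A ⇒ B} {g : B ⇒ C} {h : D ⇒ E} {k : E ⇒ F} →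
             (f ⨾ g) ⊗₁ (h ⨾ k) ≈ (f ⊗₁ h) ⨾ (g ⊗₁ k)
    ⊗-resp-≈ : ∀ {A B C D} {f f' : A ⇒ B} {g g' : C ⇒ D} →
               f ≈ f' → g ≈ g' → f ⊗₁ g ≈ f' ⊗₁ g'
    α    : ∀ {X Y Z} → ((X ⊗₀ Y) ⊗₀ Z) ⇒ (X ⊗₀ (Y ⊗₀ Z))
    α⁻¹  : ∀ {X Y Z} → (X ⊗₀ (Y ⊗₀ Z)) ⇒ ((X ⊗₀ Y) ⊗₀ Z)
    λ'   : ∀ X → X ⇒ (I ⊗₀ X)
    λ⁻¹  : ∀ X → (I ⊗₀ X) ⇒ X
    ρ    : ∀ X → X ⇒ (X ⊗₀ I)
    ρ⁻¹  : ∀ X → (X ⊗₀ I) ⇒ X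
    σ    : ∀ {X Y} → (X ⊗₀ Y) ⇒ (Y ⊗₀ X)
    α-iso₁ : ∀ {X Y Z} → α {X} {Y} {Z} ⨾ α⁻¹ ≈ id
    α-iso₂ : ∀ {X Y Z} → α⁻¹ ⨾ α {X} {Y} {Z} ≈ id
    λ-iso₁ : ∀ {X} → λ' X ⨾ λ⁻¹ X ≈ id
    λ-iso₂ : ∀ {X} → λ⁻¹ X ⨾ λ' X ≈ id
    ρ-iso₁ : ∀ {X} → ρ X ⨾ ρ⁻¹ X ≈ id
    ρ-iso₂ : ∀ {X} → ρ⁻¹ X ⨾ ρ X ≈ id
    σ-invol : ∀ {X Y} → σ {X} {Y} ⨾ σ ≈ id
    α-natural : ∀ {A B C D E F} {f : A ⇒ B} {g : C ⇒ D} {h : E ⇒ F} →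
                ((f ⊗₁ g) ⊗₁ h) ⨾ α ≈ α ⨾ (f ⊗₁ (g ⊗₁ h))
    λ-natural : ∀ {A B} {f : A ⇒ B} → f ⨾ λ' B ≈ λ' A ⨾ (id ⊗₁ f)
    ρ-natural : ∀ {A B} {f : A ⇒ B} → f ⨾ ρ B ≈ ρ A ⨾ (f ⊗₁ id)
    σ-natural : ∀ {A B C D} {f : A ⇒ B} {g : C ⇒ D} →
                (f ⊗₁ g) ⨾ σ ≈ σ ⨾ (g ⊗₁ f)
    pentagon : ∀ {W X Y Z} →
               (α {W} {X} {Y} ⊗₁ id {Z}) ⨾ (α ⨾ (id ⊗₁ α)) ≈ α ⨾ α
    triangle : ∀ {X Y} → (ρ X ⊗₁ id {Y}) ⨾ α ≈ id ⊗₁ λ' Y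
    hexagon  : ∀ {X Y Z} →
               α {X} {Y} {Z} ⨾ (σ ⨾ α) ≈ (σ ⊗₁ id) ⨾ (α ⨾ (id ⊗₁ σ))

  τ : ∀ {X Y Z W} → ((X ⊗₀ Y) ⊗₀ (Z ⊗₀ W)) ⇒ ((X ⊗₀ Z) ⊗₀ (Y ⊗₀ W))
  τ = α ⨾ ((id ⊗₁ (α⁻¹ ⨾ ((σ ⊗₁ id) ⨾ α))) ⨾ α⁻¹)

record GSMonoidal {o ℓ e} (C : Category o ℓ e) : Set (o ⊔ ℓ ⊔ e) where
  open Category C
  field
    smc : SymmetricMonoidal C
  open SymmetricMonoidal smc
  field
    ! : ∀ X → X ⇒ I
    ∇ : ∀ X → X ⇒ (X ⊗₀ X)
    ∇-coassoc : ∀ {X} → ∇ X ⨾ ((∇ X ⊗₁ id) ⨾ α) ≈ ∇ X ⨾ (id ⊗₁ ∇ X)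
    ∇-cocomm  : ∀ {X} → ∇ X ⨾ σ ≈ ∇ X
    counitˡ   : ∀ {X} → ∇ X ⨾ (! X ⊗₁ id) ≈ λ' X
    counitʳ   : ∀ {X} → ∇ X ⨾ (id ⊗₁ ! X) ≈ ρ X
    !-unit   : ! I ≈ id
    !-tensor : ∀ {X Y} → ! (X ⊗₀ Y) ≈ (! X ⊗₁ ! Y) ⨾ λ⁻¹ I
    ∇-unit   : ∇ I ≈ λ' I
    ∇-tensor : ∀ {X Y} → ∇ (X ⊗₀ Y) ≈ (∇ X ⊗₁ ∇ Y) ⨾ τ

  dom : ∀ {X Y} → X ⇒ Y → X ⇒ X
  dom {X} {Y} f = (∇ X ⨾ (id ⊗₁ (f ⨾ ! Y))) ⨾ ρ⁻¹ X

-- A restriction category (in the sense of the paper): a gs-monoidal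
-- category in which ∇ is natural: f ⨾ ∇Y ≈ ∇X ⨾ (f ⊗ f).
record RestrictionCategory (o ℓ e : Level) : Set (suc (o ⊔ ℓ ⊔ e)) where
  field
    cat : Category o ℓ e
    gs  : GSMonoidal cat
  open Category cat
  open GSMonoidal gs
  open SymmetricMonoidal smc
  field
    ∇-natural : ∀ {X Y} (f : X ⇒ Y) → f ⨾ ∇ Y ≈ ∇ X ⨾ (f ⊗₁ f)

record Monad {o ℓ e} (C : Category o ℓ e) : Set (o ⊔ ℓ ⊔ e) where
  open Category C
  field
    T₀ : Obj → Obj
    T₁ : ∀ {A B} → A ⇒ B → T₀ A ⇒ T₀ B
    T-id   : ∀ {A} → T₁ (id {A}) ≈ id
    T-comp : ∀ {A B C} {f : A ⇒ B} {g : B ⇒ C} → T₁ (f ⨾ g) ≈ T₁ f ⨾ T₁ g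
    T-resp-≈ : ∀ {A B} {f g : A ⇒ B} → f ≈ g → T₁ f ≈ T₁ g
    η : ∀ X → X ⇒ T₀ X
    μ : ∀ X → T₀ (T₀ X) ⇒ T₀ X
    η-natural : ∀ {A B} {f : A ⇒ B} → f ⨾ η B ≈ η A ⨾ T₁ f
    μ-natural : ∀ {A B} {f : A ⇒ B} → T₁ (T₁ f) ⨾ μ B ≈ μ A ⨾ T₁ f
    unitˡ : ∀ {X} → η (T₀ X) ⨾ μ X ≈ id
    unitʳ : ∀ {X} → T₁ (η X) ⨾ μ X ≈ id
    μ-assoc : ∀ {X} → T₁ (μ X) ⨾ μ X ≈ μ (T₀ X) ⨾ μ X

record SymmetricMonoidalMonad {o ℓ e} {C : Category o ℓ e}
         (M : SymmetricMonoidal C) : Set (o ⊔ ℓ ⊔ e) where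
  open Category C
  open SymmetricMonoidal M
  field
    monad : Monad C
  open Monad monad
  field
    c : ∀ X Y → (T₀ X ⊗₀ T₀ Y) ⇒ T₀ (X ⊗₀ Y)
    c-natural : ∀ {A B C D} {f : A ⇒ B} {g : C ⇒ D} →
                (T₁ f ⊗₁ T₁ g) ⨾ c B D ≈ c A C ⨾ T₁ (f ⊗₁ g)
    c-assoc : ∀ {X Y Z} →
              (c X Y ⊗₁ id) ⨾ (c (X ⊗₀ Y) Z ⨾ T₁ α)
                ≈ α ⨾ ((id ⊗₁ c Y Z) ⨾ c X (Y ⊗₀ Z))
    c-unitˡ : ∀ {X} → λ' (T₀ X) ⨾ ((η I ⊗₁ id) ⨾ c I X) ≈ T₁ (λ' X)
    c-unitʳ : ∀ {X} → ρ (T₀ X) ⨾ ((id ⊗₁ η I) ⨾ c X I) ≈ T₁ (ρ X)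
    c-symm  : ∀ {X Y} → σ ⨾ c Y X ≈ c X Y ⨾ T₁ σ
    -- η is monoidal (its unit condition η_I = η_I is trivial)
    η-monoidal : ∀ {X Y} → (η X ⊗₁ η Y) ⨾ c X Y ≈ η (X ⊗₀ Y)
    μ-monoidal : ∀ {X Y} →
                 (μ X ⊗₁ μ Y) ⨾ c X Y ≈ c (T₀ X) (T₀ Y) ⨾ (T₁ (c X Y) ⨾ μ (X ⊗₀ Y))
    μ-monoidal-unit : η I ⨾ (T₁ (η I) ⨾ μ I) ≈ η I

IsAffine : ∀ {o ℓ e} (R : RestrictionCategory o ℓ e) →
           SymmetricMonoidalMonad (GSMonoidal.smc (RestrictionCategory.gs R)) →
           Set (o ⊔ e)
IsAffine R TT = ∀ X → T₁ (! X) ≈ ! (T₀ X) ⨾ η I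
  where
  open RestrictionCategory R
  open Category cat
  open GSMonoidal gs
  open SymmetricMonoidal smc
  open SymmetricMonoidalMonad TT
  open Monad monad

module Kleisli {o ℓ e} (R : RestrictionCategory o ℓ e)
               (TT : SymmetricMonoidalMonad
                       (GSMonoidal.smc (RestrictionCategory.gs R))) where
  open RestrictionCategory R
  open Category cat
  open GSMonoidal gs
  open SymmetricMonoidal smc
  open SymmetricMonoidalMonad TT
  open Monad monad

  _⇒♯_ : Obj → Obj → Set ℓ
  X ⇒♯ Y = X ⇒ T₀ Y

  id♯ : ∀ {X} → X ⇒♯ X
  id♯ {X} = η X

  infixr 9 _⨾♯_
  _⨾♯_ : ∀ {X Y Z} → X ⇒♯ Y → Y ⇒♯ Z → X ⇒♯ Z
  _⨾♯_ {Z = Z} f g = f ⨾ (T₁ g ⨾ μ Z)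

  _⊗♯_ : ∀ {A B C D} → A ⇒♯ B → C ⇒♯ D → (A ⊗₀ C) ⇒♯ (B ⊗₀ D)
  _⊗♯_ {B = B} {D = D} f g = (f ⊗₁ g) ⨾ c B D

  ∇♯ : ∀ X → X ⇒♯ (X ⊗₀ X)
  ∇♯ X = ∇ X ⨾ η (X ⊗₀ X)

  !♯ : ∀ X → X ⇒♯ I
  !♯ X = ! X ⨾ η I

  ρ⁻¹♯ : ∀ X → (X ⊗₀ I) ⇒♯ X
  ρ⁻¹♯ X = ρ⁻¹ X ⨾ η X

  dom♯ : ∀ {X Y} → X ⇒♯ Y → X ⇒♯ X
  dom♯ {X} {Y} f = (∇♯ X ⨾♯ (id♯ ⊗♯ (f ⨾♯ !♯ Y))) ⨾♯ ρ⁻¹♯ X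

  IsDomainKleisli : Set (o ⊔ ℓ ⊔ e)
  IsDomainKleisli = ∀ {X Y} (f : X ⇒♯ Y) → dom♯ f ⨾♯ f ≈ f

{-# OPTIONS --safe #-}
module Submission where

-- Affineness makes discarding after a Kleisli arrow pure, so the Kleisli domain
-- dom♯ f is the pure arrow dom f ⨾ η computed in the base category; there
-- dom f ⨾ f ≈ f, because naturality of ∇ turns "copy the input, run f on both
-- copies, discard one result" into f itself.

open import Defs
open import Relation.Binary.Bundles using (Setoid)
open import Relation.Binary.Structures using (IsEquivalence)
import Relation.Binary.Reasoning.Setoid as SetoidReasoning

module HomReasoning {o ℓ e} (C : Category o ℓ e) where
  open Category C

  hom-setoid : Obj → Obj → Setoid ℓ e
  hom-setoid A B = record { isEquivalence = equiv {A} {B} }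

  open module HomEquiv {A B : Obj} = IsEquivalence (equiv {A} {B}) public
    using () renaming (refl to ≈-refl; sym to ≈-sym; trans to ≈-trans)
  open module HomSetoidReasoning {A B : Obj} = SetoidReasoning (hom-setoid A B) public

  ⨾-congˡ : ∀ {A B C} {f : A ⇒ B} {g g′ : B ⇒ C} → g ≈ g′ → f ⨾ g ≈ f ⨾ g′
  ⨾-congˡ = ⨾-resp-≈ ≈-refl

  ⨾-congʳ : ∀ {A B C} {f f′ : A ⇒ B} {g : B ⇒ C} → f ≈ f′ → f ⨾ g ≈ f′ ⨾ g
  ⨾-congʳ p = ⨾-resp-≈ p ≈-refl

module MonoidalProperties {o ℓ e} {C : Category o ℓ e} (M : SymmetricMonoidal C) where
  open Category C
  open SymmetricMonoidal M
  open HomReasoning C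

  ρ⁻¹-natural : ∀ {A B} (f : A ⇒ B) → ρ⁻¹ A ⨾ f ≈ (f ⊗₁ id) ⨾ ρ⁻¹ B
  ρ⁻¹-natural {A} {B} f = begin
    ρ⁻¹ A ⨾ f                             ≈⟨ idʳ ⟨
    (ρ⁻¹ A ⨾ f) ⨾ id                      ≈⟨ ⨾-congˡ ρ-iso₁ ⟨
    (ρ⁻¹ A ⨾ f) ⨾ (ρ B ⨾ ρ⁻¹ B)           ≈⟨ ≈-trans assoc (⨾-congˡ (≈-sym assoc)) ⟩
    ρ⁻¹ A ⨾ ((f ⨾ ρ B) ⨾ ρ⁻¹ B)           ≈⟨ ⨾-congˡ (⨾-congʳ ρ-natural) ⟩
    ρ⁻¹ A ⨾ ((ρ A ⨾ (f ⊗₁ id)) ⨾ ρ⁻¹ B)   ≈⟨ ≈-trans (⨾-congˡ assoc) (≈-sym assoc) ⟩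
    (ρ⁻¹ A ⨾ ρ A) ⨾ ((f ⊗₁ id) ⨾ ρ⁻¹ B)   ≈⟨ ⨾-congʳ ρ-iso₂ ⟩
    id ⨾ ((f ⊗₁ id) ⨾ ρ⁻¹ B)              ≈⟨ idˡ ⟩
    (f ⊗₁ id) ⨾ ρ⁻¹ B                     ∎

  ⊗-serialize : ∀ {A B C D} (f : A ⇒ B) (g : C ⇒ D) → (id ⊗₁ g) ⨾ (f ⊗₁ id) ≈ f ⊗₁ g
  ⊗-serialize f g = ≈-trans (≈-sym ⊗-comp) (⊗-resp-≈ idˡ idʳ)

module RestrictionProperties {o ℓ e} (R : RestrictionCategory o ℓ e) where
  open RestrictionCategory R
  open Category cat
  open GSMonoidal gs
  open SymmetricMonoidal smc
  open HomReasoning cat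
  open MonoidalProperties smc

  ∇-⨾-discardʳ : ∀ {X Y} (f : X ⇒ Y) → ∇ X ⨾ (f ⊗₁ (f ⨾ ! Y)) ≈ f ⨾ ρ Y
  ∇-⨾-discardʳ {X} {Y} f = begin
    ∇ X ⨾ (f ⊗₁ (f ⨾ ! Y))                ≈⟨ ⨾-congˡ (⊗-resp-≈ idʳ ≈-refl) ⟨
    ∇ X ⨾ ((f ⨾ id) ⊗₁ (f ⨾ ! Y))         ≈⟨ ⨾-congˡ ⊗-comp ⟩
    ∇ X ⨾ ((f ⊗₁ f) ⨾ (id ⊗₁ ! Y))        ≈⟨ assoc ⟨
    (∇ X ⨾ (f ⊗₁ f)) ⨾ (id ⊗₁ ! Y)        ≈⟨ ⨾-congʳ (∇-natural f) ⟨
    (f ⨾ ∇ Y) ⨾ (id ⊗₁ ! Y)               ≈⟨ assoc ⟩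
    f ⨾ (∇ Y ⨾ (id ⊗₁ ! Y))               ≈⟨ ⨾-congˡ counitʳ ⟩
    f ⨾ ρ Y                               ∎

  restriction⇒domain : ∀ {X Y} (f : X ⇒ Y) → dom f ⨾ f ≈ f
  restriction⇒domain {X} {Y} f = begin
    ((∇ X ⨾ (id ⊗₁ (f ⨾ ! Y))) ⨾ ρ⁻¹ X) ⨾ f           ≈⟨ ≈-trans assoc (⨾-congˡ (ρ⁻¹-natural f)) ⟩
    (∇ X ⨾ (id ⊗₁ (f ⨾ ! Y))) ⨾ ((f ⊗₁ id) ⨾ ρ⁻¹ Y)   ≈⟨ ≈-trans (≈-sym assoc) (⨾-congʳ assoc) ⟩
    (∇ X ⨾ ((id ⊗₁ (f ⨾ ! Y)) ⨾ (f ⊗₁ id))) ⨾ ρ⁻¹ Y   ≈⟨ ⨾-congʳ (⨾-congˡ (⊗-serialize f (f ⨾ ! Y))) ⟩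
    (∇ X ⨾ (f ⊗₁ (f ⨾ ! Y))) ⨾ ρ⁻¹ Y                  ≈⟨ ⨾-congʳ (∇-⨾-discardʳ f) ⟩
    (f ⨾ ρ Y) ⨾ ρ⁻¹ Y                                 ≈⟨ ≈-trans assoc (⨾-congˡ ρ-iso₁) ⟩
    f ⨾ id                                            ≈⟨ idʳ ⟩
    f                                                 ∎

module MonadProperties {o ℓ e} {C : Category o ℓ e} (M : Monad C) where
  open Category C
  open Monad M
  open HomReasoning C

  T-pure-⨾-μ : ∀ {A B} (a : A ⇒ B) → T₁ (a ⨾ η B) ⨾ μ B ≈ T₁ a
  T-pure-⨾-μ {A} {B} a = begin
    T₁ (a ⨾ η B) ⨾ μ B         ≈⟨ ≈-trans (⨾-congʳ T-comp) assoc ⟩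
    T₁ a ⨾ (T₁ (η B) ⨾ μ B)    ≈⟨ ⨾-congˡ unitʳ ⟩
    T₁ a ⨾ id                  ≈⟨ idʳ ⟩
    T₁ a                       ∎

  pure-bind : ∀ {A B C} (k : A ⇒ B) (b : B ⇒ T₀ C) → (k ⨾ η B) ⨾ (T₁ b ⨾ μ C) ≈ k ⨾ b
  pure-bind {A} {B} {C} k b = begin
    (k ⨾ η B) ⨾ (T₁ b ⨾ μ C)       ≈⟨ ≈-trans assoc (⨾-congˡ (≈-sym assoc)) ⟩
    k ⨾ ((η B ⨾ T₁ b) ⨾ μ C)       ≈⟨ ⨾-congˡ (⨾-congʳ η-natural) ⟨
    k ⨾ ((b ⨾ η (T₀ C)) ⨾ μ C)     ≈⟨ ⨾-congˡ (≈-trans assoc (⨾-congˡ unitˡ)) ⟩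
    k ⨾ (b ⨾ id)                   ≈⟨ ⨾-congˡ idʳ ⟩
    k ⨾ b                          ∎

module MonoidalMonadProperties {o ℓ e} {C : Category o ℓ e} {M : SymmetricMonoidal C}
                               (TT : SymmetricMonoidalMonad M) where
  open Category C
  open SymmetricMonoidal M
  open SymmetricMonoidalMonad TT
  open Monad monad
  open HomReasoning C

  pure-⊗-c : ∀ {A B C D} (h : A ⇒ B) (g : C ⇒ D) →
             ((h ⨾ η B) ⊗₁ (g ⨾ η D)) ⨾ c B D ≈ (h ⊗₁ g) ⨾ η (B ⊗₀ D)
  pure-⊗-c {B = B} {D = D} h g = begin
    ((h ⨾ η B) ⊗₁ (g ⨾ η D)) ⨾ c B D      ≈⟨ ≈-trans (⨾-congʳ ⊗-comp) assoc ⟩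
    (h ⊗₁ g) ⨾ ((η B ⊗₁ η D) ⨾ c B D)     ≈⟨ ⨾-congˡ η-monoidal ⟩
    (h ⊗₁ g) ⨾ η (B ⊗₀ D)                 ∎

module KleisliProperties {o ℓ e} (R : RestrictionCategory o ℓ e)
    (TT : SymmetricMonoidalMonad (GSMonoidal.smc (RestrictionCategory.gs R)))
    (affine : IsAffine R TT) where
  open RestrictionCategory R
  open Category cat
  open GSMonoidal gs
  open SymmetricMonoidal smc
  open SymmetricMonoidalMonad TT
  open Monad monad
  open Kleisli R TT
  open HomReasoning cat
  open MonadProperties monad
  open MonoidalMonadProperties TT

  ⨾♯-cong : ∀ {X Y Z} {f f′ : X ⇒♯ Y} {g g′ : Y ⇒♯ Z} → f ≈ f′ → g ≈ g′ → f ⨾♯ g ≈ f′ ⨾♯ g′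
  ⨾♯-cong p q = ⨾-resp-≈ p (⨾-congʳ (T-resp-≈ q))

  ⨾♯-!♯ : ∀ {X Y} (f : X ⇒♯ Y) → f ⨾♯ !♯ Y ≈ (f ⨾ ! (T₀ Y)) ⨾ η I
  ⨾♯-!♯ {X} {Y} f = begin
    f ⨾ (T₁ (! Y ⨾ η I) ⨾ μ I)    ≈⟨ ⨾-congˡ (T-pure-⨾-μ (! Y)) ⟩
    f ⨾ T₁ (! Y)                  ≈⟨ ⨾-congˡ (affine Y) ⟩
    f ⨾ (! (T₀ Y) ⨾ η I)          ≈⟨ assoc ⟨
    (f ⨾ ! (T₀ Y)) ⨾ η I          ∎

  dom♯≈dom⨾η : ∀ {X Y} (f : X ⇒♯ Y) → dom♯ f ≈ dom f ⨾ η X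
  dom♯≈dom⨾η {X} {Y} f = begin
    (∇♯ X ⨾♯ (η X ⊗♯ (f ⨾♯ !♯ Y))) ⨾♯ ρ⁻¹♯ X                  ≈⟨ ⨾♯-cong (⨾♯-cong ≈-refl pure-tensor) ≈-refl ⟩
    ((∇ X ⨾ η (X ⊗₀ X)) ⨾♯ ((id ⊗₁ g) ⨾ η (X ⊗₀ I))) ⨾♯ ρ⁻¹♯ X ≈⟨ ⨾♯-cong (≈-trans (pure-bind (∇ X) _) (≈-sym assoc)) ≈-refl ⟩
    ((∇ X ⨾ (id ⊗₁ g)) ⨾ η (X ⊗₀ I)) ⨾♯ ρ⁻¹♯ X                ≈⟨ pure-bind _ (ρ⁻¹♯ X) ⟩
    (∇ X ⨾ (id ⊗₁ g)) ⨾ (ρ⁻¹ X ⨾ η X)                         ≈⟨ assoc ⟨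
    dom f ⨾ η X                                               ∎
    where
    g : X ⇒ I
    g = f ⨾ ! (T₀ Y)

    pure-tensor : η X ⊗♯ (f ⨾♯ !♯ Y) ≈ (id ⊗₁ g) ⨾ η (X ⊗₀ I)
    pure-tensor = ≈-trans (⨾-congʳ (⊗-resp-≈ (≈-sym idˡ) (⨾♯-!♯ f))) (pure-⊗-c id g)

corollary5p3 : ∀ {o ℓ e} (R : RestrictionCategory o ℓ e)
                 (TT : SymmetricMonoidalMonad (GSMonoidal.smc (RestrictionCategory.gs R))) →
                 IsAffine R TT →
                 Kleisli.IsDomainKleisli R TT
corollary5p3 R TT affine {X} f = begin
  dom♯ f ⨾♯ f          ≈⟨ ⨾♯-cong (dom♯≈dom⨾η f) ≈-refl ⟩
  (dom f ⨾ η X) ⨾♯ f   ≈⟨ pure-bind (dom f) f ⟩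
  dom f ⨾ f            ≈⟨ restriction⇒domain f ⟩
  f                    ∎
  where
  open RestrictionCategory R
  open Category cat
  open GSMonoidal gs
  open Monad (SymmetricMonoidalMonad.monad TT)
  open Kleisli R TT
  open HomReasoning cat
  open RestrictionProperties R
  open MonadProperties (SymmetricMonoidalMonad.monad TT)
  open KleisliProperties R TT affine
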